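{- Let $n$ be an odd integer, $A=S(n)$, and let $p'$ be a prime divisor of $n$ with $v_{p'}(n)\geq 2$. Let $n'=n/p'$ and let $f:U(n)\to U(n')$ be the natural map. Then $L(n';p')\subseteq f(A)$.
   Context: $\mathbb{Z}_m=\mathbb{Z}/m\mathbb{Z}$, $U(m)$ its unit group; the natural map $U(n)\to U(n')$ is reduction modulo $n'$. $v_p(n)=r$ means $p^r\mid n$ and $p^{r+1}\nmid n$. For odd $m=\prod p_i^{r_i}$ and $a\in U(m)$, $\left(\frac{a}{m}\right)=\prod_i\left(\frac{a\bmod p_i}{p_i}\right)^{r_i}$, and $\left(\frac{a}{p}\right)$ is the Legendre symbol of $a\bmod p$. $S(m)$ is the kernel of $a\mapsto\left(\frac{a}{m}\right)$ on $U(m)$, and for a prime $p'\mid m$, $L(m;p')=\{a\in U(m): \left(\frac{a}{m}\right)=\left(\frac{a}{p'}\right)\}$. -}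

module Defs where

open import Data.Nat using (ℕ; zero; suc; _*_; _<_; _%_; _/_)
open import Data.Nat.Divisibility using (_∣_; _∣?_)
open import Data.Nat.Coprimality using (Coprime)
open import Data.Nat.Primality using (Prime; prime?)
open import Data.Nat.Properties using (_≟_)
open import Data.Integer using (ℤ; 1ℤ; -1ℤ) renaming (_*_ to _*ℤ_; _^_ to _^ℤ_)
open import Data.Bool using (Bool; true; false; if_then_else_; _∧_)
open import Data.List using (List; upTo; filter; foldr; map)
open import Data.Bool.ListAction using (any)
open import Data.Product using (Σ; _×_; _,_)
open import Relation.Nullary.Decidable using (⌊_⌋; _×-dec_)
open import Relation.Binary.PropositionalEquality using (_≡_)

-- reduction modulo m (with the harmless convention a mod 0 = a)
_mod_ : ℕ → ℕ → ℕ
a mod zero = a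
a mod (suc k) = a % suc k

-- U(m) as the residues 0 ≤ a < m coprime to m
IsUnit : ℕ → ℕ → Set
IsUnit m a = a < m × Coprime a m

isQR : ℕ → ℕ → Bool
isQR a p = any (λ x → ⌊ (x * x) mod p ≟ a mod p ⌋) (upTo p)

legendre : ℕ → ℕ → ℤ
legendre a p = if isQR a p then 1ℤ else -1ℤ

-- p-adic valuation v_p(m) (fuel = m suffices); v_p(0) = 0 by convention (unused)
val : ℕ → ℕ → ℕ
val zero m = zero
val (suc zero) m = zero
val p@(suc (suc q)) m = go m m
  where
  go : ℕ → ℕ → ℕ
  go zero _ = zero
  go (suc k) zero = zero
  go (suc k) r@(suc _) = if ⌊ p ∣? r ⌋ then suc (go k (r / p)) else zero

jacobi : ℕ → ℕ → ℤ
jacobi a m = foldr (λ p acc → legendre a p ^ℤ val p m *ℤ acc) 1ℤ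
               (filter (λ p → prime? p ×-dec (p ∣? m)) (upTo (suc m)))

InS : ℕ → ℕ → Set
InS m a = IsUnit m a × jacobi a m ≡ 1ℤ

InL : ℕ → ℕ → ℕ → Set
InL m p' a = IsUnit m a × jacobi a m ≡ legendre a p'

{-# OPTIONS --safe #-}
module Submission where

-- The witness is b itself.  The Jacobi symbol is multiplicative in the modulus:
-- passing from n' to n = n' p' raises v_p'(n') by one and leaves every other
-- valuation unchanged, so (b/n) = (b/p') (b/n') = (b/p')² = 1.  Since p' already
-- divides n', b stays a unit modulo n.

open import Defs
import Algebra.Properties.CommutativeSemigroup as CommutativeSemigroupProperties
open import Data.Bool using (true; false; if_then_else_)
open import Data.Empty using (⊥-elim)
open import Data.Integer using (ℤ; 1ℤ) renaming (_*_ to _*ℤ_; _^_ to _^ℤ_)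
import Data.Integer.Properties as ℤ
open import Data.List using (List; []; _∷_; _∷ʳ_; foldr; filter; upTo)
open import Data.List.Properties using (upTo-∷ʳ)
open import Data.Nat
open import Data.Nat.Coprimality using (Coprime; coprime-divisor)
open import Data.Nat.Divisibility
open import Data.Nat.DivMod using (_/_; m/n<m; m*n/n≡m; m<n⇒m%n≡m)
open import Data.Nat.Induction using (<-rec)
open import Data.Nat.Primality
open import Data.Nat.Properties
open import Data.Product using (Σ; _×_; _,_; proj₁; proj₂)
open import Data.Sum using (inj₁; inj₂)
open import Function using (_∘_)
open import Relation.Nullary using (¬_; Dec; yes; no; does)
open import Relation.Nullary.Decidable using (_×-dec_; dec-true; dec-false)
open import Relation.Unary using (Pred; Decidable)
open import Relation.Binary.PropositionalEquality

open CommutativeSemigroupProperties *-commutativeSemigroup using (xy∙z≈xz∙y)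
open CommutativeSemigroupProperties ℤ.*-commutativeSemigroup using (x∙yz≈y∙xz)

-- `valLoop q m k r` is the local loop `go` of `val (2+ q) m` with fuel k on the value r.
-- It cannot be named directly, so it is a metavariable solved by unification in
-- `val-unfold`, where `with` abstraction leaves `go` applied to distinct variables.
mutual
  valLoop : ℕ → ℕ → ℕ → ℕ → ℕ
  valLoop = _

  val-unfold : ∀ q k → 2+ q ∣ suc k →
               val (2+ q) (suc k) ≡ suc (valLoop q (suc k) k (suc k / 2+ q))
  val-unfold q k p∣m with 2+ q ∣? suc k
  ... | no p∤m = ⊥-elim (p∤m p∣m)
  ... | yes _ with suc k / 2+ q
  ...   | r with suc k
  ...     | m = refl

valLoop-zero : ∀ q m k → valLoop q m k 0 ≡ 0
valLoop-zero q m zero    = refl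
valLoop-zero q m (suc k) = refl

valLoop-stop : ∀ q m k r → ¬ 2+ q ∣ suc r → valLoop q m (suc k) (suc r) ≡ 0
valLoop-stop q m k r p∤r with 2+ q ∣? suc r
... | yes p∣r = ⊥-elim (p∤r p∣r)
... | no _    = refl

valLoop-fuel : ∀ q m m' k k' r → r ≤ k → r ≤ k' → valLoop q m k r ≡ valLoop q m' k' r
valLoop-fuel q m m' k       k'       zero    _          _ = trans (valLoop-zero q m k) (sym (valLoop-zero q m' k'))
valLoop-fuel q m m' (suc k) (suc k') (suc r) (s≤s r≤k) (s≤s r≤k') with 2+ q ∣? suc r
... | yes _ = cong suc (valLoop-fuel q m m' k k' (suc r / 2+ q) (≤-trans r/p≤r r≤k) (≤-trans r/p≤r r≤k'))
  where
  r/p≤r : suc r / 2+ q ≤ r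
  r/p≤r = ≤-pred (m/n<m (suc r) (2+ q) (s≤s (s≤s z≤n)))
... | no _  = refl

val-indivisible : ∀ p m → ¬ p ∣ m → val p m ≡ 0
val-indivisible zero       m       _   = refl
val-indivisible (suc zero) m       _   = refl
val-indivisible (2+ q)     zero    p∤m = ⊥-elim (p∤m (_ ∣0))
val-indivisible (2+ q)     (suc k) p∤m = valLoop-stop q (suc k) k k p∤m

val-*-self : ∀ p m .{{_ : NonTrivial p}} .{{_ : NonZero m}} → val p (m * p) ≡ suc (val p m)
val-*-self (2+ q) m@(suc k) = begin
  val (2+ q) (m * 2+ q)
    ≡⟨ val-unfold q fuel (n∣m*n m) ⟩
  suc (valLoop q (m * 2+ q) fuel (m * 2+ q / 2+ q))
    ≡⟨ cong (λ r → suc (valLoop q (m * 2+ q) fuel r)) (m*n/n≡m m (2+ q)) ⟩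
  suc (valLoop q (m * 2+ q) fuel m)
    ≡⟨ cong suc (valLoop-fuel q (m * 2+ q) m fuel m m m≤fuel ≤-refl) ⟩
  suc (val (2+ q) m)
    ∎
  where
  open ≡-Reasoning
  fuel : ℕ
  fuel = suc (q + k * 2+ q)
  m≤fuel : m ≤ fuel
  m≤fuel = s≤s (≤-trans (m≤m*n k (2+ q)) (m≤n+m _ q))

val-*-indivisible : ∀ {p c} → Prime p → ¬ p ∣ c → ∀ m → val p (m * c) ≡ val p m
val-*-indivisible {p} {zero}      _  p∤c = ⊥-elim (p∤c (p ∣0))
val-*-indivisible {p} {c@(suc _)} pp p∤c = <-rec _ step
  where
  instance _ = prime⇒nonTrivial pp
  step : ∀ m → (∀ {k} → k < m → val p (k * c) ≡ val p k) → val p (m * c) ≡ val p m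
  step m ih with p ∣? m
  ... | no p∤m = trans (val-indivisible p (m * c) p∤m*c) (sym (val-indivisible p m p∤m))
    where
    p∤m*c : ¬ p ∣ m * c
    p∤m*c p∣m*c with euclidsLemma m c pp p∣m*c
    ... | inj₁ p∣m = p∤m p∣m
    ... | inj₂ p∣c = p∤c p∣c
  step .(zero * p) ih | yes (divides-refl zero) = refl
  step .(k * p) ih | yes (divides-refl k@(suc _)) = begin
    val p (k * p * c)   ≡⟨ cong (val p) (xy∙z≈xz∙y k p c) ⟩
    val p (k * c * p)   ≡⟨ val-*-self p (k * c) ⟩
    suc (val p (k * c)) ≡⟨ cong suc (ih (m<m*n k p (nonTrivial⇒n>1 p))) ⟩
    suc (val p k)       ≡⟨ sym (val-*-self p k) ⟩
    val p (k * p)       ∎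
    where open ≡-Reasoning

∏ : (ℕ → ℤ) → List ℕ → ℤ
∏ f = foldr (λ x acc → f x *ℤ acc) 1ℤ

∏-filter : ∀ {ℓ} {P : Pred ℕ ℓ} (P? : Decidable P) f xs →
           ∏ f (filter P? xs) ≡ ∏ (λ x → if does (P? x) then f x else 1ℤ) xs
∏-filter P? f []       = refl
∏-filter P? f (x ∷ xs) with does (P? x)
... | true  = cong (f x *ℤ_) (∏-filter P? f xs)
... | false = trans (∏-filter P? f xs) (sym (ℤ.*-identityˡ _))

∏-∷ʳ : ∀ f xs x → ∏ f (xs ∷ʳ x) ≡ ∏ f xs *ℤ f x
∏-∷ʳ f []       x = trans (ℤ.*-identityʳ (f x)) (sym (ℤ.*-identityˡ (f x)))
∏-∷ʳ f (y ∷ xs) x = trans (cong (f y *ℤ_) (∏-∷ʳ f xs x)) (sym (ℤ.*-assoc (f y) _ _))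

∏-upTo-suc : ∀ f k → ∏ f (upTo (suc k)) ≡ ∏ f (upTo k) *ℤ f k
∏-upTo-suc f k = trans (cong (∏ f) (sym (upTo-∷ʳ k))) (∏-∷ʳ f (upTo k) k)

∏-upTo-cong : ∀ {f g} k → (∀ {x} → x < k → f x ≡ g x) → ∏ f (upTo k) ≡ ∏ g (upTo k)
∏-upTo-cong {f} {g} zero    _   = refl
∏-upTo-cong {f} {g} (suc k) f≡g = begin
  ∏ f (upTo (suc k))  ≡⟨ ∏-upTo-suc f k ⟩
  ∏ f (upTo k) *ℤ f k ≡⟨ cong₂ _*ℤ_ (∏-upTo-cong k (f≡g ∘ m<n⇒m<1+n)) (f≡g ≤-refl) ⟩
  ∏ g (upTo k) *ℤ g k ≡⟨ sym (∏-upTo-suc g k) ⟩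
  ∏ g (upTo (suc k))  ∎
  where open ≡-Reasoning

∏-upTo-ones : ∀ {f m k} → (∀ {x} → m ≤ x → f x ≡ 1ℤ) → m ≤ k → ∏ f (upTo k) ≡ ∏ f (upTo m)
∏-upTo-ones {f} {m} f≡1 m≤k = go (≤⇒≤′ m≤k)
  where
  go : ∀ {k} → m ≤′ k → ∏ f (upTo k) ≡ ∏ f (upTo m)
  go ≤′-refl              = refl
  go (≤′-step {k} m≤′k) = begin
    ∏ f (upTo (suc k))  ≡⟨ ∏-upTo-suc f k ⟩
    ∏ f (upTo k) *ℤ f k ≡⟨ cong₂ _*ℤ_ (go m≤′k) (f≡1 (≤′⇒≤ m≤′k)) ⟩
    ∏ f (upTo m) *ℤ 1ℤ  ≡⟨ ℤ.*-identityʳ _ ⟩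
    ∏ f (upTo m)        ∎
    where open ≡-Reasoning

∏-upTo-scale-at : ∀ {f g c l k} → (∀ {x} → x ≢ c → f x ≡ g x) → f c ≡ l *ℤ g c → c < k →
                  ∏ f (upTo k) ≡ l *ℤ ∏ g (upTo k)
∏-upTo-scale-at {f} {g} {c} {l} f≡g fc c<k = go (≤⇒≤′ c<k)
  where
  open ≡-Reasoning
  go : ∀ {k} → suc c ≤′ k → ∏ f (upTo k) ≡ l *ℤ ∏ g (upTo k)
  go ≤′-refl = begin
    ∏ f (upTo (suc c))         ≡⟨ ∏-upTo-suc f c ⟩
    ∏ f (upTo c) *ℤ f c        ≡⟨ cong₂ _*ℤ_ (∏-upTo-cong c (f≡g ∘ <⇒≢)) fc ⟩
    ∏ g (upTo c) *ℤ (l *ℤ g c) ≡⟨ x∙yz≈y∙xz (∏ g (upTo c)) l (g c) ⟩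
    l *ℤ (∏ g (upTo c) *ℤ g c) ≡⟨ cong (l *ℤ_) (sym (∏-upTo-suc g c)) ⟩
    l *ℤ ∏ g (upTo (suc c))    ∎
  go (≤′-step {k} c<′k) = begin
    ∏ f (upTo (suc k))         ≡⟨ ∏-upTo-suc f k ⟩
    ∏ f (upTo k) *ℤ f k        ≡⟨ cong₂ _*ℤ_ (go c<′k) (f≡g (>⇒≢ (≤′⇒≤ c<′k))) ⟩
    l *ℤ ∏ g (upTo k) *ℤ g k   ≡⟨ ℤ.*-assoc l _ _ ⟩
    l *ℤ (∏ g (upTo k) *ℤ g k) ≡⟨ cong (l *ℤ_) (sym (∏-upTo-suc g k)) ⟩
    l *ℤ ∏ g (upTo (suc k))    ∎

jacobiFactor : ℕ → ℕ → ℕ → ℤ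
jacobiFactor b m p = if does (prime? p ×-dec (p ∣? m)) then legendre b p ^ℤ val p m else 1ℤ

jacobi≡∏ : ∀ b m → jacobi b m ≡ ∏ (jacobiFactor b m) (upTo (suc m))
jacobi≡∏ b m = ∏-filter (λ p → prime? p ×-dec (p ∣? m)) (λ p → legendre b p ^ℤ val p m) (upTo (suc m))

if-dec-yes : ∀ {a ℓ} {A : Set a} {P : Set ℓ} (P? : Dec P) {x y : A} → P → (if does P? then x else y) ≡ x
if-dec-yes P? p rewrite dec-true P? p = refl

if-dec-no : ∀ {a ℓ} {A : Set a} {P : Set ℓ} (P? : Dec P) {x y : A} → ¬ P → (if does P? then x else y) ≡ y
if-dec-no P? ¬p rewrite dec-false P? ¬p = refl

jacobiFactor-prime : ∀ b m {p} → Prime p → jacobiFactor b m p ≡ legendre b p ^ℤ val p m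
jacobiFactor-prime b m {p} pp = by-divisibility (p ∣? m)
  where
  by-divisibility : Dec (p ∣ m) → jacobiFactor b m p ≡ legendre b p ^ℤ val p m
  by-divisibility (yes p∣m) = if-dec-yes (prime? p ×-dec (p ∣? m)) (pp , p∣m)
  by-divisibility (no p∤m)  = trans (if-dec-no (prime? p ×-dec (p ∣? m)) (p∤m ∘ proj₂))
                                    (sym (cong (legendre b p ^ℤ_) (val-indivisible p m p∤m)))

jacobiFactor-nonprime : ∀ b m {p} → ¬ Prime p → jacobiFactor b m p ≡ 1ℤ
jacobiFactor-nonprime b m {p} ¬pp = if-dec-no (prime? p ×-dec (p ∣? m)) (¬pp ∘ proj₁)

jacobiFactor-above : ∀ b m {p} .{{_ : NonZero m}} → m < p → jacobiFactor b m p ≡ 1ℤ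
jacobiFactor-above b m {p} m<p = if-dec-no (prime? p ×-dec (p ∣? m)) (<⇒≱ m<p ∘ ∣⇒≤ ∘ proj₂)

jacobi≡∏-upTo : ∀ b m {k} .{{_ : NonZero m}} → m < k → jacobi b m ≡ ∏ (jacobiFactor b m) (upTo k)
jacobi≡∏-upTo b m m<k = trans (jacobi≡∏ b m) (sym (∏-upTo-ones (jacobiFactor-above b m) m<k))

prime-∤-prime : ∀ {p q} → Prime p → Prime q → p ≢ q → ¬ p ∣ q
prime-∤-prime pp pq p≢q p∣q with prime⇒irreducible pq p∣q
... | inj₁ p≡1 = nonTrivial⇒≢1 {{prime⇒nonTrivial pp}} p≡1
... | inj₂ p≡q = p≢q p≡q

jacobiFactor-*-other : ∀ b m {p x} → Prime p → x ≢ p → jacobiFactor b (m * p) x ≡ jacobiFactor b m x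
jacobiFactor-*-other b m {p} {x} pp x≢p = by-primality (prime? x)
  where
  open ≡-Reasoning
  by-primality : Dec (Prime x) → jacobiFactor b (m * p) x ≡ jacobiFactor b m x
  by-primality (yes px) = begin
    jacobiFactor b (m * p) x      ≡⟨ jacobiFactor-prime b (m * p) px ⟩
    legendre b x ^ℤ val x (m * p) ≡⟨ cong (legendre b x ^ℤ_) (val-*-indivisible px x∤p m) ⟩
    legendre b x ^ℤ val x m       ≡⟨ sym (jacobiFactor-prime b m px) ⟩
    jacobiFactor b m x            ∎
    where x∤p = prime-∤-prime px pp x≢p
  by-primality (no ¬px) = trans (jacobiFactor-nonprime b (m * p) ¬px) (sym (jacobiFactor-nonprime b m ¬px))

jacobiFactor-*-self : ∀ b m {p} .{{_ : NonZero m}} → Prime p →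
                      jacobiFactor b (m * p) p ≡ legendre b p *ℤ jacobiFactor b m p
jacobiFactor-*-self b m {p} pp = begin
  jacobiFactor b (m * p) p                ≡⟨ jacobiFactor-prime b (m * p) pp ⟩
  legendre b p ^ℤ val p (m * p)           ≡⟨ cong (legendre b p ^ℤ_) (val-*-self p m) ⟩
  legendre b p *ℤ legendre b p ^ℤ val p m ≡⟨ cong (legendre b p *ℤ_) (sym (jacobiFactor-prime b m pp)) ⟩
  legendre b p *ℤ jacobiFactor b m p      ∎
  where
  open ≡-Reasoning
  instance _ = prime⇒nonTrivial pp

jacobi-*-prime : ∀ b m {p} .{{_ : NonZero m}} → Prime p → jacobi b (m * p) ≡ legendre b p *ℤ jacobi b m
jacobi-*-prime b m {p} pp = begin
  jacobi b (m * p)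
    ≡⟨ jacobi≡∏-upTo b (m * p) ≤-refl ⟩
  ∏ (jacobiFactor b (m * p)) (upTo (suc (m * p)))
    ≡⟨ ∏-upTo-scale-at {l = legendre b p} (jacobiFactor-*-other b m pp) (jacobiFactor-*-self b m pp)
                       (s≤s (∣⇒≤ (n∣m*n m))) ⟩
  legendre b p *ℤ ∏ (jacobiFactor b m) (upTo (suc (m * p)))
    ≡⟨ cong (legendre b p *ℤ_) (sym (jacobi≡∏-upTo b m (s≤s (m≤m*n m p)))) ⟩
  legendre b p *ℤ jacobi b m
    ∎
  where
  open ≡-Reasoning
  instance
    _ = prime⇒nonZero pp
    _ = m*n≢0 m p

legendre-*-self : ∀ a p → legendre a p *ℤ legendre a p ≡ 1ℤ
legendre-*-self a p with isQR a p
... | true  = refl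
... | false = refl

coprime-*-divisor : ∀ {a m d} → Coprime a m → d ∣ m → Coprime a (m * d)
coprime-*-divisor {a} {m} {d} a⊥m d∣m {i} (i∣a , i∣m*d) = a⊥m (i∣a , ∣-trans i∣d d∣m)
  where
  i⊥m : Coprime i m
  i⊥m (j∣i , j∣m) = a⊥m (∣-trans j∣i i∣a , j∣m)
  i∣d : i ∣ d
  i∣d = coprime-divisor i⊥m i∣m*d

mod-< : ∀ {a m} → a < m → a mod m ≡ a
mod-< {m = suc _} a<m = m<n⇒m%n≡m a<m

lemma4p1 : (n p' n' : ℕ) → ¬ (2 ∣ n) → Prime p' → p' ^ 2 ∣ n → n ≡ n' * p'
    → (b : ℕ) → InL n' p' b
    → Σ ℕ (λ a → InS n a × a mod n' ≡ b)
lemma4p1 _ p n' _ pp p²∣n refl b ((b<n' , b⊥n') , jacobi≡legendre) =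
  b , ((b<n , coprime-*-divisor b⊥n' p∣n') , jacobi≡1) , mod-< b<n'
  where
  instance
    _ = prime⇒nonZero pp
    _ = >-nonZero (≤-<-trans z≤n b<n')
  p∣n' : p ∣ n'
  p∣n' = *-cancelʳ-∣ p (subst (_∣ n' * p) (cong (p *_) (*-identityʳ p)) p²∣n)
  b<n : b < n' * p
  b<n = <-≤-trans b<n' (m≤m*n n' p)
  jacobi≡1 : jacobi b (n' * p) ≡ 1ℤ
  jacobi≡1 = begin
    jacobi b (n' * p)            ≡⟨ jacobi-*-prime b n' pp ⟩
    legendre b p *ℤ jacobi b n'  ≡⟨ cong (legendre b p *ℤ_) jacobi≡legendre ⟩
    legendre b p *ℤ legendre b p ≡⟨ legendre-*-self b p ⟩
    1ℤ                           ∎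
    where open ≡-Reasoning
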